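{- Let $B$ be the bull. Then $rb(K_n,B) \geq n+2$ for all $n \geq 6$.
   Context: The bull $B$ is the unique graph with $5$ vertices and degree sequence $(1,1,2,3,3)$ (a triangle with pendant edges attached at two distinct vertices). For a graph $H$ and an integer $n$, the rainbow number $rb(K_n,H)$ is the minimum number $m$ such that every edge-colouring of $K_n$ using at least $m$ colours contains a rainbow copy of $H$ (a subgraph isomorphic to $H$ whose edges all have distinct colours). -}

module Defs where

open import Data.Nat using (ℕ; _<_; _≤_)
open import Data.Fin using (Fin; zero; suc)
open import Data.Product using (Σ; ∃; ∃-syntax; _×_; _,_; proj₁; proj₂)
open import Relation.Binary.PropositionalEquality using (_≡_; _≢_)
open import Relation.Nullary using (¬_)
open import Function.Definitions using (Injective)

-- An edge-colouring of K_n with colours in ℕ: a symmetric function on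
-- pairs of vertices; only values on pairs i ≢ j (edges) are meaningful.
record Colouring (n : ℕ) : Set where
  field
    col : Fin n → Fin n → ℕ
    sym : ∀ i j → col i j ≡ col j i
open Colouring public

UsesAtLeast : {n : ℕ} → Colouring n → ℕ → Set
UsesAtLeast {n} c m =
  Σ (Fin m → ℕ) λ f → Injective _≡_ _≡_ f ×
    (∀ k → ∃[ i ] ∃[ j ] (i ≢ j × col c i j ≡ f k))

-- The bull on vertex set Fin 5: triangle 0,1,2, pendant 3 at 0, pendant 4 at 1.
bullEdge : Fin 5 → Fin 5 × Fin 5
bullEdge zero                         = zero , suc zero
bullEdge (suc zero)                   = suc zero , suc (suc zero)
bullEdge (suc (suc zero))             = suc (suc zero) , zero
bullEdge (suc (suc (suc zero)))       = zero , suc (suc (suc zero))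
bullEdge (suc (suc (suc (suc zero)))) = suc zero , suc (suc (suc (suc zero)))

RainbowBull : {n : ℕ} → Colouring n → Set
RainbowBull {n} c =
  Σ (Fin 5 → Fin n) λ v → Injective _≡_ _≡_ v ×
    Injective _≡_ _≡_ (λ e → col c (v (proj₁ (bullEdge e))) (v (proj₂ (bullEdge e))))

-- m belongs to the set whose minimum is rb(K_n, B): every colouring of K_n
-- using at least m colours contains a rainbow bull.
Forces : ℕ → ℕ → Set
Forces n m = (c : Colouring n) → UsesAtLeast c m → RainbowBull c

RbBullAtLeast : ℕ → ℕ → Set
RbBullAtLeast n k = ∀ m → m < k → ¬ Forces n m

-- Split the vertices of K_n into blocks, each a triangle or a 4-cycle (possible for every
-- n ≥ 6), give the n edges inside the blocks n distinct colours and every edge between two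
-- blocks the extra colour 0: this uses n + 1 colours. A rainbow bull has at most one edge
-- of colour 0, and its other four edges stay inside one block. If both pendant edges are
-- among them, five vertices lie in one block, which has at most four. Otherwise the triangle
-- has nonzero colours, so it is a triangle block, and the nonzero pendant edge leaves it.
module Submission where

open import Defs hiding (sym)
open import Data.Nat using (ℕ; zero; suc; _+_; _≤_; _<_; s≤s; _≟_; _<?_)
open import Data.Nat.Properties
  using (<-irrefl; ≤-pred; ≮⇒≥; m≤n⇒∃[o]m+o≡n; +-cancelˡ-<; +-comm)
open import Data.Fin using (Fin; zero; suc; #_; toℕ; inject₁; inject≤)
open import Data.Fin.Properties
  using (all?; injective⇒≤; inject₁-injective; inject≤-injective; toℕ-injective; toℕ<n; +↔⊎)
  renaming (_≟_ to _≟ᶠ_)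
open import Data.List using (List; []; _∷_; map)
open import Data.List.Relation.Unary.Any using (here; there)
open import Data.List.Membership.Propositional using (_∈_; _∉_)
open import Data.List.Membership.Propositional.Properties using (∈-map⁺; ∈-map⁻)
open import Data.Sum using (_⊎_; inj₁; inj₂; [_,_]′)
open import Data.Sum.Properties using (inj₁-injective; inj₂-injective)
open import Data.Product using (Σ; ∃-syntax; _×_; _,_; proj₁; proj₂)
open import Data.Unit using (⊤; tt)
open import Data.Empty using (⊥; ⊥-elim)
open import Function using (_∘_; _↔_; Inverse; Injection)
open import Function.Properties.Inverse using (↔-sym; ↔⇒↣)
open import Function.Definitions using (Injective)
open import Relation.Binary.PropositionalEquality
  using (_≡_; _≢_; refl; sym; trans; cong; subst; subst₂)
open import Relation.Nullary using (¬_; yes; no; ¬?)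
open import Relation.Nullary.Decidable using (from-yes; _×-dec_; _→-dec_)

∈-map⁻-injective : {A B : Set} {f : A → B} {x : A} {xs : List A} →
                   Injective _≡_ _≡_ f → f x ∈ map f xs → x ∈ xs
∈-map⁻-injective f-inj fx∈ with ∈-map⁻ _ fx∈
... | y , y∈ , fx≡fy = subst (_∈ _) (sym (f-inj fx≡fy)) y∈

OccursIn : {V : Set} → (V → V → ℕ) → ℕ → Set
OccursIn {V} colour c = ∃[ i ] ∃[ j ] (i ≢ j × colour i j ≡ c)

-- Colour 0 is the background colour between blocks; `slot` numbers the vertices within
-- each block, so that a block has at most four vertices.
record BlockColouring (V : Set) (k : ℕ) : Set₁ where
  field
    colour            : V → V → ℕ
    colour-sym        : ∀ i j → colour i j ≡ colour j i
    Block             : Set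
    block             : V → Block
    slot              : V → Fin 4
    slot-injective    : ∀ {i j} → block i ≡ block j → slot i ≡ slot j → i ≡ j
    nonzero⇒sameBlock : ∀ {i j} → colour i j ≢ 0 → block i ≡ block j
    triangle-fills    : ∀ {a b c d} → colour a b ≢ 0 → colour b c ≢ 0 → colour c a ≢ 0 →
                        block d ≡ block a → d ∈ a ∷ b ∷ c ∷ []
    palette           : ∀ {c} → c < k → OccursIn colour (suc c)

HasBackgroundEdge : {V : Set} {k : ℕ} → BlockColouring V k → Set
HasBackgroundEdge C = OccursIn (BlockColouring.colour C) 0

toColouring : {n k : ℕ} → BlockColouring (Fin n) k → Colouring n
toColouring C = record { col = colour ; sym = colour-sym }
  where open BlockColouring C

module _ {V : Set} {k : ℕ} (C : BlockColouring V k) where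
  open BlockColouring C

  no-five-in-a-block : ∀ β (w : Fin 5 → V) → Injective _≡_ _≡_ w → ¬ (∀ i → block (w i) ≡ β)
  no-five-in-a-block β w w-inj w∈β = <-irrefl refl (injective⇒≤ slot∘w-injective)
    where
    slot∘w-injective : Injective _≡_ _≡_ (slot ∘ w)
    slot∘w-injective {i} {j} = w-inj ∘ slot-injective (trans (w∈β i) (sym (w∈β j)))

  bull-not-rainbow : (v : Fin 5 → V) → Injective _≡_ _≡_ v →
    ¬ Injective _≡_ _≡_ (λ e → colour (v (proj₁ (bullEdge e))) (v (proj₂ (bullEdge e))))
  bull-not-rainbow v v-inj rainbow = pendants
    where
    a = v (# 0); b = v (# 1); c = v (# 2); d = v (# 3); e = v (# 4)

    edgeColour : Fin 5 → ℕ
    edgeColour z = colour (v (proj₁ (bullEdge z))) (v (proj₂ (bullEdge z)))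

    zero-unique : ∀ z y → z ≢ y → edgeColour z ≡ 0 → edgeColour y ≢ 0
    zero-unique z y z≢y z≡0 y≡0 = z≢y (rainbow (trans z≡0 (sym y≡0)))

    a~b : block a ≡ block b
    a~b with colour a b ≟ 0
    ... | no  ab≢0 = nonzero⇒sameBlock ab≢0
    ... | yes ab≡0 = sym (trans (nonzero⇒sameBlock (zero-unique (# 0) (# 1) (λ ()) ab≡0))
                                (nonzero⇒sameBlock (zero-unique (# 0) (# 2) (λ ()) ab≡0)))

    a~c : block a ≡ block c
    a~c with colour c a ≟ 0
    ... | no  ca≢0 = sym (nonzero⇒sameBlock ca≢0)
    ... | yes ca≡0 = trans (nonzero⇒sameBlock (zero-unique (# 2) (# 0) (λ ()) ca≡0))
                           (nonzero⇒sameBlock (zero-unique (# 2) (# 1) (λ ()) ca≡0))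

    in-triangle : ∀ z p → z ≢ # 0 → z ≢ # 1 → z ≢ # 2 → edgeColour z ≡ 0 →
                  block (v p) ≡ block a → p ∈ # 0 ∷ # 1 ∷ # 2 ∷ []
    in-triangle z p z≢0 z≢1 z≢2 z≡0 p~a = ∈-map⁻-injective v-inj
      (triangle-fills (zero-unique z (# 0) z≢0 z≡0) (zero-unique z (# 1) z≢1 z≡0)
                      (zero-unique z (# 2) z≢2 z≡0) p~a)

    pendant∉triangle : ∀ {p} → toℕ p ≡ 3 ⊎ toℕ p ≡ 4 → p ∉ # 0 ∷ # 1 ∷ # 2 ∷ []
    pendant∉triangle (inj₁ ()) (here refl)
    pendant∉triangle (inj₂ ()) (here refl)
    pendant∉triangle (inj₁ ()) (there (here refl))
    pendant∉triangle (inj₂ ()) (there (here refl))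
    pendant∉triangle (inj₁ ()) (there (there (here refl)))
    pendant∉triangle (inj₂ ()) (there (there (here refl)))

    pendants : ⊥
    pendants with colour a d ≟ 0 | colour b e ≟ 0
    ... | yes ad≡0 | _ =
      let be≢0 = zero-unique (# 3) (# 4) (λ ()) ad≡0 in
      pendant∉triangle (inj₂ refl) (in-triangle (# 3) (# 4) (λ ()) (λ ()) (λ ()) ad≡0
        (sym (trans a~b (nonzero⇒sameBlock be≢0))))
    ... | no ad≢0 | yes be≡0 =
      pendant∉triangle (inj₁ refl) (in-triangle (# 4) (# 3) (λ ()) (λ ()) (λ ()) be≡0
        (sym (nonzero⇒sameBlock ad≢0)))
    ... | no ad≢0 | no be≢0 = no-five-in-a-block (block a) v v-inj λ where
      zero                          → refl
      (suc zero)                    → sym a~b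
      (suc (suc zero))              → sym a~c
      (suc (suc (suc zero)))        → sym (nonzero⇒sameBlock ad≢0)
      (suc (suc (suc (suc zero))))  → sym (trans a~b (nonzero⇒sameBlock be≢0))

noRainbowBull : {n k : ℕ} (C : BlockColouring (Fin n) k) → ¬ RainbowBull (toColouring C)
noRainbowBull C (v , v-inj , rainbow) = bull-not-rainbow C v v-inj rainbow

triangleColour : Fin 3 → Fin 3 → ℕ
triangleColour zero             (suc zero)       = 1
triangleColour (suc zero)       zero             = 1
triangleColour (suc zero)       (suc (suc zero)) = 2
triangleColour (suc (suc zero)) (suc zero)       = 2
triangleColour (suc (suc zero)) zero             = 3
triangleColour zero             (suc (suc zero)) = 3
triangleColour _                _                = 0

triangle : BlockColouring (Fin 3) 3
triangle = record
  { colour            = triangleColour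
  ; colour-sym        = from-yes (all? λ i → all? λ j → triangleColour i j ≟ triangleColour j i)
  ; Block             = ⊤
  ; block             = λ _ → tt
  ; slot              = inject₁
  ; slot-injective    = λ _ → inject₁-injective
  ; nonzero⇒sameBlock = λ _ → refl
  ; triangle-fills    = λ {a} {b} {c} {d} ab bc ca _ → fills a b c d ab bc ca
  ; palette           = palette
  }
  where
  open import Data.List.Membership.DecPropositional (_≟ᶠ_ {3}) using (_∈?_)

  fills : ∀ a b c d → triangleColour a b ≢ 0 → triangleColour b c ≢ 0 →
          triangleColour c a ≢ 0 → d ∈ a ∷ b ∷ c ∷ []
  fills = from-yes (all? λ a → all? λ b → all? λ c → all? λ d →
    ¬? (triangleColour a b ≟ 0) →-dec ¬? (triangleColour b c ≟ 0) →-dec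
    ¬? (triangleColour c a ≟ 0) →-dec d ∈? a ∷ b ∷ c ∷ [])

  palette : ∀ {c} → c < 3 → OccursIn triangleColour (suc c)
  palette {0} _ = # 0 , # 1 , (λ ()) , refl
  palette {1} _ = # 1 , # 2 , (λ ()) , refl
  palette {2} _ = # 2 , # 0 , (λ ()) , refl
  palette {suc (suc (suc _))} (s≤s (s≤s (s≤s ())))

squareColour : Fin 4 → Fin 4 → ℕ
squareColour zero                   (suc zero)             = 1
squareColour (suc zero)             zero                   = 1
squareColour (suc zero)             (suc (suc zero))       = 2
squareColour (suc (suc zero))       (suc zero)             = 2
squareColour (suc (suc zero))       (suc (suc (suc zero))) = 3
squareColour (suc (suc (suc zero))) (suc (suc zero))       = 3
squareColour (suc (suc (suc zero))) zero                   = 4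
squareColour zero                   (suc (suc (suc zero))) = 4
squareColour _                      _                      = 0

square : BlockColouring (Fin 4) 4
square = record
  { colour            = squareColour
  ; colour-sym        = from-yes (all? λ i → all? λ j → squareColour i j ≟ squareColour j i)
  ; Block             = ⊤
  ; block             = λ _ → tt
  ; slot              = λ i → i
  ; slot-injective    = λ _ i≡j → i≡j
  ; nonzero⇒sameBlock = λ _ → refl
  ; triangle-fills    = λ {a} {b} {c} ab bc ca _ → ⊥-elim (triangle-free a b c (ab , bc , ca))
  ; palette           = palette
  }
  where
  triangle-free : ∀ a b c →
    ¬ (squareColour a b ≢ 0 × squareColour b c ≢ 0 × squareColour c a ≢ 0)
  triangle-free = from-yes (all? λ a → all? λ b → all? λ c →
    ¬? (¬? (squareColour a b ≟ 0) ×-dec ¬? (squareColour b c ≟ 0) ×-dec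
        ¬? (squareColour c a ≟ 0)))

  palette : ∀ {c} → c < 4 → OccursIn squareColour (suc c)
  palette {0} _ = # 0 , # 1 , (λ ()) , refl
  palette {1} _ = # 1 , # 2 , (λ ()) , refl
  palette {2} _ = # 2 , # 3 , (λ ()) , refl
  palette {3} _ = # 3 , # 0 , (λ ()) , refl
  palette {suc (suc (suc (suc _)))} (s≤s (s≤s (s≤s (s≤s ()))))

module _ {A B : Set} {k l : ℕ} (G : BlockColouring A k) (H : BlockColouring B l) where
  private
    module G = BlockColouring G
    module H = BlockColouring H

  shift : ℕ → ℕ
  shift zero    = zero
  shift (suc c) = suc (k + c)

  shift-nonzero : ∀ {c} → shift c ≢ 0 → c ≢ 0
  shift-nonzero {zero}  shift≢0 = ⊥-elim (shift≢0 refl)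
  shift-nonzero {suc c} _       = λ ()

  colour⊕ : A ⊎ B → A ⊎ B → ℕ
  colour⊕ (inj₁ x) (inj₁ y) = G.colour x y
  colour⊕ (inj₂ x) (inj₂ y) = shift (H.colour x y)
  colour⊕ (inj₁ _) (inj₂ _) = 0
  colour⊕ (inj₂ _) (inj₁ _) = 0

  block⊕ : A ⊎ B → G.Block ⊎ H.Block
  block⊕ (inj₁ x) = inj₁ (G.block x)
  block⊕ (inj₂ y) = inj₂ (H.block y)

  colour⊕-sym : ∀ i j → colour⊕ i j ≡ colour⊕ j i
  colour⊕-sym (inj₁ x) (inj₁ y) = G.colour-sym x y
  colour⊕-sym (inj₂ x) (inj₂ y) = cong shift (H.colour-sym x y)
  colour⊕-sym (inj₁ _) (inj₂ _) = refl
  colour⊕-sym (inj₂ _) (inj₁ _) = refl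

  slot⊕ : A ⊎ B → Fin 4
  slot⊕ = [ G.slot , H.slot ]′

  slot⊕-injective : ∀ {i j} → block⊕ i ≡ block⊕ j → slot⊕ i ≡ slot⊕ j → i ≡ j
  slot⊕-injective {inj₁ _} {inj₁ _} i~j = cong inj₁ ∘ G.slot-injective (inj₁-injective i~j)
  slot⊕-injective {inj₂ _} {inj₂ _} i~j = cong inj₂ ∘ H.slot-injective (inj₂-injective i~j)

  nonzero⇒sameBlock⊕ : ∀ {i j} → colour⊕ i j ≢ 0 → block⊕ i ≡ block⊕ j
  nonzero⇒sameBlock⊕ {inj₁ _} {inj₁ _} ij≢0 = cong inj₁ (G.nonzero⇒sameBlock ij≢0)
  nonzero⇒sameBlock⊕ {inj₂ _} {inj₂ _} ij≢0 = cong inj₂ (H.nonzero⇒sameBlock (shift-nonzero ij≢0))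
  nonzero⇒sameBlock⊕ {inj₁ _} {inj₂ _} ij≢0 = ⊥-elim (ij≢0 refl)
  nonzero⇒sameBlock⊕ {inj₂ _} {inj₁ _} ij≢0 = ⊥-elim (ij≢0 refl)

  triangle-fills⊕ : ∀ {a b c d} → colour⊕ a b ≢ 0 → colour⊕ b c ≢ 0 → colour⊕ c a ≢ 0 →
                    block⊕ d ≡ block⊕ a → d ∈ a ∷ b ∷ c ∷ []
  triangle-fills⊕ {inj₁ _} {inj₁ _} {inj₁ _} {inj₁ _} ab bc ca d~a =
    ∈-map⁺ inj₁ (G.triangle-fills ab bc ca (inj₁-injective d~a))
  triangle-fills⊕ {inj₂ _} {inj₂ _} {inj₂ _} {inj₂ _} ab bc ca d~a =
    ∈-map⁺ inj₂ (H.triangle-fills (shift-nonzero ab) (shift-nonzero bc) (shift-nonzero ca)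
                                  (inj₂-injective d~a))
  triangle-fills⊕ {inj₁ _} {inj₁ _} {inj₁ _} {inj₂ _} _  _  _ ()
  triangle-fills⊕ {inj₂ _} {inj₂ _} {inj₂ _} {inj₁ _} _  _  _ ()
  triangle-fills⊕ {inj₁ _} {inj₁ _} {inj₂ _}          _  bc _ _ = ⊥-elim (bc refl)
  triangle-fills⊕ {inj₂ _} {inj₂ _} {inj₁ _}          _  bc _ _ = ⊥-elim (bc refl)
  triangle-fills⊕ {inj₁ _} {inj₂ _}                   ab _  _ _ = ⊥-elim (ab refl)
  triangle-fills⊕ {inj₂ _} {inj₁ _}                   ab _  _ _ = ⊥-elim (ab refl)

  palette⊕ : ∀ {c} → c < k + l → OccursIn colour⊕ (suc c)
  palette⊕ {c} c<k+l with c <? k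
  ... | yes c<k with G.palette c<k
  ...   | i , j , i≢j , ij≡c = inj₁ i , inj₁ j , i≢j ∘ inj₁-injective , ij≡c
  palette⊕ {c} c<k+l | no c≮k with m≤n⇒∃[o]m+o≡n (≮⇒≥ c≮k)
  ... | o , refl with H.palette (+-cancelˡ-< k o l c<k+l)
  ...   | i , j , i≢j , ij≡o = inj₂ i , inj₂ j , i≢j ∘ inj₂-injective , cong shift ij≡o

  _⊕_ : BlockColouring (A ⊎ B) (k + l)
  _⊕_ = record
    { colour            = colour⊕
    ; colour-sym        = colour⊕-sym
    ; Block             = G.Block ⊎ H.Block
    ; block             = block⊕
    ; slot              = slot⊕
    ; slot-injective    = slot⊕-injective
    ; nonzero⇒sameBlock = nonzero⇒sameBlock⊕
    ; triangle-fills    = triangle-fills⊕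
    ; palette           = palette⊕
    }

  ⊕-background : A → B → HasBackgroundEdge _⊕_
  ⊕-background x y = inj₁ x , inj₂ y , (λ ()) , refl

module _ {V W : Set} {k : ℕ} (W↔V : W ↔ V) (C : BlockColouring V k) where
  open Inverse W↔V using (to; from; strictlyInverseˡ)
  open BlockColouring C

  to-injective : Injective _≡_ _≡_ to
  to-injective = Injection.injective (↔⇒↣ W↔V)

  occurs-pullback : ∀ {c} → OccursIn colour c → OccursIn (λ x y → colour (to x) (to y)) c
  occurs-pullback (i , j , i≢j , ij≡c) =
    from i , from j , i≢j ∘ Injection.injective (↔⇒↣ (↔-sym W↔V)) ,
    subst₂ (λ x y → colour x y ≡ _) (sym (strictlyInverseˡ i)) (sym (strictlyInverseˡ j)) ij≡c

  relabel : BlockColouring W k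
  relabel = record
    { colour            = λ x y → colour (to x) (to y)
    ; colour-sym        = λ x y → colour-sym (to x) (to y)
    ; Block             = Block
    ; block             = block ∘ to
    ; slot              = slot ∘ to
    ; slot-injective    = λ x~y sx≡sy → to-injective (slot-injective x~y sx≡sy)
    ; nonzero⇒sameBlock = nonzero⇒sameBlock
    ; triangle-fills    = λ ab bc ca d~a → ∈-map⁻-injective to-injective (triangle-fills ab bc ca d~a)
    ; palette           = occurs-pullback ∘ palette
    }

  relabel-background : HasBackgroundEdge C → HasBackgroundEdge relabel
  relabel-background = occurs-pullback

_⊞_ : ∀ {m n k l} → BlockColouring (Fin m) k → BlockColouring (Fin n) l →
      BlockColouring (Fin (m + n)) (k + l)
G ⊞ H = relabel +↔⊎ (G ⊕ H)

⊞-background : ∀ {m n k l} (G : BlockColouring (Fin (suc m)) k) (H : BlockColouring (Fin (suc n)) l) →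
               HasBackgroundEdge (G ⊞ H)
⊞-background G H = relabel-background +↔⊎ (G ⊕ H) (⊕-background G H zero zero)

blockCover : ∀ r → Σ (BlockColouring (Fin (6 + r)) (6 + r)) HasBackgroundEdge
blockCover 0 = triangle ⊞ triangle , ⊞-background triangle triangle
blockCover 1 = triangle ⊞ square , ⊞-background triangle square
blockCover 2 = square ⊞ square , ⊞-background square square
blockCover (suc (suc (suc r))) = triangle ⊞ C , ⊞-background triangle C
  where C = proj₁ (blockCover r)

usesAtLeast-mono : ∀ {n m m′} {c : Colouring n} → m′ ≤ m → UsesAtLeast c m → UsesAtLeast c m′
usesAtLeast-mono m′≤m (f , f-inj , f-occurs) =
  (λ i → f (inject≤ i m′≤m)) , inject≤-injective m′≤m m′≤m _ _ ∘ f-inj , (λ i → f-occurs (inject≤ i m′≤m))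

usesAtLeast-suc : ∀ {n k} (C : BlockColouring (Fin n) k) → HasBackgroundEdge C →
                  UsesAtLeast (toColouring C) (suc k)
usesAtLeast-suc C background = toℕ , toℕ-injective , occurs
  where
  occurs : ∀ i → OccursIn (BlockColouring.colour C) (toℕ i)
  occurs zero    = background
  occurs (suc i) = BlockColouring.palette C (toℕ<n i)

lemma1 : (n : ℕ) → 6 ≤ n → RbBullAtLeast n (n + 2)
lemma1 n 6≤n m m<n+2 forces with m≤n⇒∃[o]m+o≡n 6≤n
... | r , refl with blockCover r
...   | C , background = noRainbowBull C (forces (toColouring C) usesAtLeast-m)
  where
  m≤n+1 : m ≤ suc (6 + r)
  m≤n+1 = ≤-pred (subst (suc m ≤_) (+-comm (6 + r) 2) m<n+2)

  usesAtLeast-m : UsesAtLeast (toColouring C) m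
  usesAtLeast-m = usesAtLeast-mono {c = toColouring C} m≤n+1 (usesAtLeast-suc C background)
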